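{- Let $\mathbb{C}$ and $\mathbb{A}$ be categories, $P\colon\mathbb{C}^{\mathrm{op}}\to\mathbb{A}$ and $S^{\mathrm{op}}\colon\mathbb{A}\to\mathbb{C}^{\mathrm{op}}$ functors with $S^{\mathrm{op}}\dashv P$, $F\colon\mathbb{C}\to\mathbb{C}$ and $M\colon\mathbb{A}\to\mathbb{A}$ endofunctors, and $\delta\colon MP\Rightarrow PF^{\mathrm{op}}$ a natural transformation. Assume $\mathbb{C}$ has finite limits, $M$ has an initial algebra $\beta\colon ML\xrightarrow{\cong}L$, and $F$ has a final coalgebra $\zeta\colon Z\xrightarrow{\cong}FZ$. Then the following are equivalent: (i) for every $F$-coalgebra $c\colon X\to FX$, $\mathsf{TestEq}_c\cong\mathsf{FCSEq}_c$ as subobjects of $X\times X$; (ii) the theory map $\mathsf{th}_\zeta\colon Z\to SL$ of the final coalgebra is a monomorphism.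
   Context: For a coalgebra $c\colon X\to FX$: the interpretation $[\![\cdot]\!]_c\colon L\to PX$ is the unique arrow in $\mathbb{A}$ with $[\![\cdot]\!]_c\circ\beta=Pc\circ\delta_X\circ M[\![\cdot]\!]_c$ (here $Pc\colon PFX\to PX$); the theory map $\mathsf{th}_c\colon X\to SL$ in $\mathbb{C}$ is the transpose of $[\![\cdot]\!]_c$ under the adjunction $\mathbb{A}(L,PX)\cong\mathbb{C}(X,SL)$. $\mathsf{TestEq}_c\rightarrowtail X\times X$ is the equalizer of $\mathsf{th}_c\circ\pi_1,\mathsf{th}_c\circ\pi_2$. With $\mathsf{beh}_c\colon X\to Z$ the unique coalgebra morphism from $c$ to $\zeta$, $\mathsf{FCSEq}_c\rightarrowtail X\times X$ is the equalizer of $\mathsf{beh}_c\circ\pi_1,\mathsf{beh}_c\circ\pi_2$. -}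

module Defs where

open import Level using (Level; _⊔_; suc)
open import Relation.Binary using (IsEquivalence)

record Category (o ℓ e : Level) : Set (suc (o ⊔ ℓ ⊔ e)) where
  infix  4 _≈_
  infixr 9 _∘_
  field
    Obj  : Set o
    _⇒_  : Obj → Obj → Set ℓ
    _≈_  : ∀ {A B} → A ⇒ B → A ⇒ B → Set e
    id   : ∀ {A} → A ⇒ A
    _∘_  : ∀ {A B C} → B ⇒ C → A ⇒ B → A ⇒ C
    equiv     : ∀ {A B} → IsEquivalence (_≈_ {A} {B})
    assoc     : ∀ {A B C D} {f : A ⇒ B} {g : B ⇒ C} {h : C ⇒ D} →
                (h ∘ g) ∘ f ≈ h ∘ (g ∘ f)
    sym-assoc : ∀ {A B C D} {f : A ⇒ B} {g : B ⇒ C} {h : C ⇒ D} →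
                h ∘ (g ∘ f) ≈ (h ∘ g) ∘ f
    identityˡ : ∀ {A B} {f : A ⇒ B} → id ∘ f ≈ f
    identityʳ : ∀ {A B} {f : A ⇒ B} → f ∘ id ≈ f
    ∘-resp-≈  : ∀ {A B C} {f h : B ⇒ C} {g i : A ⇒ B} →
                f ≈ h → g ≈ i → f ∘ g ≈ h ∘ i

op : ∀ {o ℓ e} → Category o ℓ e → Category o ℓ e
op C = record
  { Obj = Obj
  ; _⇒_ = λ A B → B ⇒ A
  ; _≈_ = _≈_
  ; id = id
  ; _∘_ = λ f g → g ∘ f
  ; equiv = equiv
  ; assoc = sym-assoc
  ; sym-assoc = assoc
  ; identityˡ = identityʳ
  ; identityʳ = identityˡ
  ; ∘-resp-≈ = λ p q → ∘-resp-≈ q p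
  }
  where open Category C

record Functor {o ℓ e o' ℓ' e'} (C : Category o ℓ e) (D : Category o' ℓ' e')
       : Set (o ⊔ ℓ ⊔ e ⊔ o' ⊔ ℓ' ⊔ e') where
  private
    module C = Category C
    module D = Category D
  field
    F₀ : C.Obj → D.Obj
    F₁ : ∀ {A B} → A C.⇒ B → F₀ A D.⇒ F₀ B
    identity     : ∀ {A} → F₁ (C.id {A}) D.≈ D.id
    homomorphism : ∀ {X Y Z} {f : X C.⇒ Y} {g : Y C.⇒ Z} →
                   F₁ (g C.∘ f) D.≈ F₁ g D.∘ F₁ f
    F-resp-≈     : ∀ {A B} {f g : A C.⇒ B} → f C.≈ g → F₁ f D.≈ F₁ g

_∘F_ : ∀ {o ℓ e o' ℓ' e' o'' ℓ'' e''}
         {C : Category o ℓ e} {D : Category o' ℓ' e'} {E : Category o'' ℓ'' e''} →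
       Functor D E → Functor C D → Functor C E
_∘F_ {C = C} {D} {E} G H = record
  { F₀ = λ X → G.F₀ (H.F₀ X)
  ; F₁ = λ f → G.F₁ (H.F₁ f)
  ; identity = E.Equiv.trans (G.F-resp-≈ H.identity) G.identity
  ; homomorphism = E.Equiv.trans (G.F-resp-≈ H.homomorphism) G.homomorphism
  ; F-resp-≈ = λ p → G.F-resp-≈ (H.F-resp-≈ p)
  }
  where
    module G = Functor G
    module H = Functor H
    module E where
      open Category E public
      module Equiv {A B : Obj} = IsEquivalence (equiv {A} {B})

idF : ∀ {o ℓ e} {C : Category o ℓ e} → Functor C C
idF {C = C} = record
  { F₀ = λ X → X ; F₁ = λ f → f
  ; identity = IsEquivalence.refl equiv
  ; homomorphism = IsEquivalence.refl equiv
  ; F-resp-≈ = λ p → p }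
  where open Category C

opF : ∀ {o ℓ e o' ℓ' e'} {C : Category o ℓ e} {D : Category o' ℓ' e'} →
      Functor C D → Functor (op C) (op D)
opF F = record
  { F₀ = F₀ ; F₁ = F₁ ; identity = identity
  ; homomorphism = homomorphism ; F-resp-≈ = F-resp-≈ }
  where open Functor F

record NatTrans {o ℓ e o' ℓ' e'} {C : Category o ℓ e} {D : Category o' ℓ' e'}
       (F G : Functor C D) : Set (o ⊔ ℓ ⊔ e ⊔ o' ⊔ ℓ' ⊔ e') where
  private
    module C = Category C
    module D = Category D
    module F = Functor F
    module G = Functor G
  field
    η       : ∀ X → F.F₀ X D.⇒ G.F₀ X
    commute : ∀ {X Y} (f : X C.⇒ Y) → η Y D.∘ F.F₁ f D.≈ G.F₁ f D.∘ η X

record Adjoint {o ℓ e o' ℓ' e'} {C : Category o ℓ e} {D : Category o' ℓ' e'}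
       (L : Functor C D) (R : Functor D C) : Set (o ⊔ ℓ ⊔ e ⊔ o' ⊔ ℓ' ⊔ e') where
  private
    module C = Category C
    module D = Category D
    module L = Functor L
    module R = Functor R
  field
    unit   : NatTrans idF (R ∘F L)
    counit : NatTrans (L ∘F R) idF
  private
    module unit = NatTrans unit
    module counit = NatTrans counit
  field
    zig : ∀ {A} → counit.η (L.F₀ A) D.∘ L.F₁ (unit.η A) D.≈ D.id
    zag : ∀ {B} → R.F₁ (counit.η B) C.∘ unit.η (R.F₀ B) C.≈ C.id

module _ {o ℓ e} (C : Category o ℓ e) where
  open Category C

  Mono : ∀ {A B} → A ⇒ B → Set (o ⊔ ℓ ⊔ e)
  Mono {A} f = ∀ {X} (g h : X ⇒ A) → f ∘ g ≈ f ∘ h → g ≈ h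

  record Terminal : Set (o ⊔ ℓ ⊔ e) where
    field
      ⊤        : Obj
      !        : ∀ {A} → A ⇒ ⊤
      !-unique : ∀ {A} (f : A ⇒ ⊤) → ! ≈ f

  record Product (A B : Obj) : Set (o ⊔ ℓ ⊔ e) where
    field
      A×B   : Obj
      π₁    : A×B ⇒ A
      π₂    : A×B ⇒ B
      ⟨_,_⟩ : ∀ {X} → X ⇒ A → X ⇒ B → X ⇒ A×B
      project₁ : ∀ {X} {f : X ⇒ A} {g : X ⇒ B} → π₁ ∘ ⟨ f , g ⟩ ≈ f
      project₂ : ∀ {X} {f : X ⇒ A} {g : X ⇒ B} → π₂ ∘ ⟨ f , g ⟩ ≈ g
      unique   : ∀ {X} {h : X ⇒ A×B} {f : X ⇒ A} {g : X ⇒ B} →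
                 π₁ ∘ h ≈ f → π₂ ∘ h ≈ g → ⟨ f , g ⟩ ≈ h

  record Equalizer {A B : Obj} (f g : A ⇒ B) : Set (o ⊔ ℓ ⊔ e) where
    field
      obj      : Obj
      arr      : obj ⇒ A
      equality : f ∘ arr ≈ g ∘ arr
      equalize : ∀ {X} {h : X ⇒ A} → f ∘ h ≈ g ∘ h → X ⇒ obj
      universal : ∀ {X} {h : X ⇒ A} {eq : f ∘ h ≈ g ∘ h} → h ≈ arr ∘ equalize eq
      unique    : ∀ {X} {h : X ⇒ A} {i : X ⇒ obj} {eq : f ∘ h ≈ g ∘ h} →
                  h ≈ arr ∘ i → i ≈ equalize eq

  record FiniteLimits : Set (o ⊔ ℓ ⊔ e) where
    field
      terminal  : Terminal
      product   : ∀ A B → Product A B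
      equalizer : ∀ {A B} (f g : A ⇒ B) → Equalizer f g

  SameSubobject : ∀ {X Y₁ Y₂} → Y₁ ⇒ X → Y₂ ⇒ X → Set (ℓ ⊔ e)
  SameSubobject {X} {Y₁} {Y₂} m₁ m₂ =
    Σ' (Y₁ ⇒ Y₂) (λ u → Σ' (Y₂ ⇒ Y₁) (λ v → (m₂ ∘ u ≈ m₁) ×' (m₁ ∘ v ≈ m₂)))
    where
      open import Data.Product using () renaming (Σ to Σ'; _×_ to _×'_)

module _ {o ℓ e} {C : Category o ℓ e} (F : Functor C C) where
  open Category C
  open Functor F

  record Coalgebra : Set (o ⊔ ℓ) where
    field
      X : Obj
      c : X ⇒ F₀ X

  IsCoalgHom : (c d : Coalgebra) → Coalgebra.X c ⇒ Coalgebra.X d → Set e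
  IsCoalgHom c d h = Coalgebra.c d ∘ h ≈ F₁ h ∘ Coalgebra.c c

  record FinalCoalgebra : Set (o ⊔ ℓ ⊔ e) where
    field
      coalg   : Coalgebra
      unfold  : (c : Coalgebra) → Coalgebra.X c ⇒ Coalgebra.X coalg
      unfold-hom    : (c : Coalgebra) → IsCoalgHom c coalg (unfold c)
      unfold-unique : (c : Coalgebra) (h : Coalgebra.X c ⇒ Coalgebra.X coalg) →
                      IsCoalgHom c coalg h → h ≈ unfold c

module _ {o ℓ e} {A : Category o ℓ e} (M : Functor A A) where
  open Category A
  open Functor M

  record Algebra : Set (o ⊔ ℓ) where
    field
      X : Obj
      a : F₀ X ⇒ X

  IsAlgHom : (a b : Algebra) → Algebra.X a ⇒ Algebra.X b → Set e
  IsAlgHom a b h = h ∘ Algebra.a a ≈ Algebra.a b ∘ F₁ h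

  record InitialAlgebra : Set (o ⊔ ℓ ⊔ e) where
    field
      alg  : Algebra
      fold : (b : Algebra) → Algebra.X alg ⇒ Algebra.X b
      fold-hom    : (b : Algebra) → IsAlgHom alg b (fold b)
      fold-unique : (b : Algebra) (h : Algebra.X alg ⇒ Algebra.X b) →
                    IsAlgHom alg b h → h ≈ fold b

module Setting
  {o ℓ e o' ℓ' e'} {C : Category o ℓ e} {A : Category o' ℓ' e'}
  (P : Functor (op C) A) (Sop : Functor A (op C)) (adj : Adjoint Sop P)
  (F : Functor C C) (M : Functor A A)
  (δ : NatTrans (M ∘F P) (P ∘F opF F))
  (lim : FiniteLimits C) (ini : InitialAlgebra M) (fin : FinalCoalgebra F)
  where
  private
    module C = Category C
    module A = Category A
    module P = Functor P
    module S = Functor Sop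
    module F = Functor F
    module δ = NatTrans δ
    module adj = Adjoint adj
    module ε = NatTrans adj.counit
    module ini = InitialAlgebra ini
    module fin = FinalCoalgebra fin
    module lim = FiniteLimits lim

  L : A.Obj
  L = Algebra.X ini.alg

  SL : C.Obj
  SL = S.F₀ L

  PAlg : Coalgebra F → Algebra M
  PAlg c = record { X = P.F₀ (Coalgebra.X c)
                  ; a = P.F₁ (Coalgebra.c c) A.∘ δ.η (Coalgebra.X c) }

  interp : (c : Coalgebra F) → L A.⇒ P.F₀ (Coalgebra.X c)
  interp c = ini.fold (PAlg c)

  -- transpose under A(L, P X) ≅ C^op(S^op L, X) = C(X, S L)
  transpose : ∀ {X} → L A.⇒ P.F₀ X → X C.⇒ SL
  transpose {X} f = S.F₁ f C.∘ ε.η X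

  th : (c : Coalgebra F) → Coalgebra.X c C.⇒ SL
  th c = transpose (interp c)

  beh : (c : Coalgebra F) → Coalgebra.X c C.⇒ Coalgebra.X fin.coalg
  beh c = fin.unfold c

  module _ (c : Coalgebra F) where
    private
      module Pr = Product (lim.product (Coalgebra.X c) (Coalgebra.X c))

    XX : C.Obj
    XX = Pr.A×B

    TestEq : Equalizer C (th c C.∘ Pr.π₁) (th c C.∘ Pr.π₂)
    TestEq = lim.equalizer _ _

    FCSEq : Equalizer C (beh c C.∘ Pr.π₁) (beh c C.∘ Pr.π₂)
    FCSEq = lim.equalizer _ _

  TestEq≅FCSEq : Coalgebra F → Set (ℓ ⊔ e)
  TestEq≅FCSEq c = SameSubobject C (Equalizer.arr (TestEq c)) (Equalizer.arr (FCSEq c))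

  thζ : Coalgebra.X fin.coalg C.⇒ SL
  thζ = th fin.coalg

module Submission where

-- Both sides are kernel-pair statements.  The key fact is that th factors
-- through behaviour: th_ζ ∘ beh_c ≈ th_c.  It follows from naturality of the
-- interpretation in coalgebra morphisms (fold fusion for the initial algebra
-- β, using that P h is an algebra morphism between the algebras Pc ∘ δ) and
-- naturality of the adjoint transpose.
--  (ii ⇒ i) If th_ζ is mono, th_c = th_ζ ∘ beh_c and beh_c have the same
--    kernel pair, so their equalizers are the same subobject.
--  (i ⇒ ii) For c = ζ we have beh_ζ ≈ id, so FCSEq_ζ lies in the diagonal;
--    as TestEq_ζ factors through it, the kernel pair of th_ζ lies in the
--    diagonal, which means th_ζ is mono.

open import Data.Product using (_,_)
open import Function.Bundles using (_⇔_; mk⇔; module Equivalence)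
open import Relation.Binary using (Setoid; IsEquivalence)
import Relation.Binary.Reasoning.Setoid as SetoidReasoning
open import Defs

module HomReasoning {o ℓ e} (C : Category o ℓ e) where
  open Category C public

  hom-setoid : ∀ {X Y} → Setoid ℓ e
  hom-setoid {X} {Y} = record { Carrier = X ⇒ Y ; _≈_ = _≈_ ; isEquivalence = equiv }

  module _ {X Y : Obj} where
    open IsEquivalence (equiv {X} {Y}) public using (refl; sym; trans)
    open SetoidReasoning (hom-setoid {X} {Y}) public

  ∘-congˡ : ∀ {X Y Z} {f h : Y ⇒ Z} {g : X ⇒ Y} → f ≈ h → f ∘ g ≈ h ∘ g
  ∘-congˡ p = ∘-resp-≈ p refl

  ∘-congʳ : ∀ {X Y Z} {f : Y ⇒ Z} {g i : X ⇒ Y} → g ≈ i → f ∘ g ≈ f ∘ i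
  ∘-congʳ p = ∘-resp-≈ refl p

module Equalizers {o ℓ e} (C : Category o ℓ e) where
  open HomReasoning C

  equalizers-same-subobject :
    ∀ {A B B'} {f₁ f₂ : A ⇒ B} {g₁ g₂ : A ⇒ B'}
    (E : Equalizer C f₁ f₂) (E' : Equalizer C g₁ g₂) →
    (∀ {X} {h : X ⇒ A} → (f₁ ∘ h ≈ f₂ ∘ h) ⇔ (g₁ ∘ h ≈ g₂ ∘ h)) →
    SameSubobject C (Equalizer.arr E) (Equalizer.arr E')
  equalizers-same-subobject E E' same =
      E'.equalize (Equivalence.to same E.equality)
    , E.equalize (Equivalence.from same E'.equality)
    , sym E'.universal
    , sym E.universal
    where
      module E = Equalizer E
      module E' = Equalizer E'

  mono-factor-same-kernel :
    ∀ {A X Y Z} {s : X ⇒ Z} {t : Y ⇒ Z} {b : X ⇒ Y} {p q : A ⇒ X} →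
    Mono C t → s ≈ t ∘ b →
    ∀ {W} {h : W ⇒ A} →
    ((s ∘ p) ∘ h ≈ (s ∘ q) ∘ h) ⇔ ((b ∘ p) ∘ h ≈ (b ∘ q) ∘ h)
  mono-factor-same-kernel {s = s} {t} {b} {p} {q} mono s≈tb {h = h} =
    mk⇔ (λ eq → mono _ _ (through-t eq)) back
    where
      expand : ∀ r → (s ∘ r) ∘ h ≈ t ∘ ((b ∘ r) ∘ h)
      expand r = begin
        (s ∘ r) ∘ h         ≈⟨ ∘-congˡ (∘-congˡ s≈tb) ⟩
        ((t ∘ b) ∘ r) ∘ h   ≈⟨ assoc ⟩
        (t ∘ b) ∘ (r ∘ h)   ≈⟨ assoc ⟩
        t ∘ (b ∘ (r ∘ h))   ≈⟨ ∘-congʳ sym-assoc ⟩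
        t ∘ ((b ∘ r) ∘ h)   ∎
      through-t : (s ∘ p) ∘ h ≈ (s ∘ q) ∘ h →
                  t ∘ ((b ∘ p) ∘ h) ≈ t ∘ ((b ∘ q) ∘ h)
      through-t eq = trans (sym (expand p)) (trans eq (expand q))
      back : (b ∘ p) ∘ h ≈ (b ∘ q) ∘ h → (s ∘ p) ∘ h ≈ (s ∘ q) ∘ h
      back eq = trans (expand p) (trans (∘-congʳ eq) (sym (expand q)))

  equalized-same-subobject :
    ∀ {A B D₁ D₂} {p q : A ⇒ B} {m₁ : D₁ ⇒ A} {m₂ : D₂ ⇒ A} →
    SameSubobject C m₁ m₂ → p ∘ m₂ ≈ q ∘ m₂ → p ∘ m₁ ≈ q ∘ m₁
  equalized-same-subobject {p = p} {q} {m₁} {m₂} (u , _ , m₂u≈m₁ , _) pm₂≈qm₂ =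
    begin
      p ∘ m₁         ≈⟨ ∘-congʳ (sym m₂u≈m₁) ⟩
      p ∘ (m₂ ∘ u)   ≈⟨ sym-assoc ⟩
      (p ∘ m₂) ∘ u   ≈⟨ ∘-congˡ pm₂≈qm₂ ⟩
      (q ∘ m₂) ∘ u   ≈⟨ assoc ⟩
      q ∘ (m₂ ∘ u)   ≈⟨ ∘-congʳ m₂u≈m₁ ⟩
      q ∘ m₁         ∎

  equalizer-of-identity :
    ∀ {A B} {b : B ⇒ B} {p q : A ⇒ B} → b ≈ id →
    (E : Equalizer C (b ∘ p) (b ∘ q)) →
    p ∘ Equalizer.arr E ≈ q ∘ Equalizer.arr E
  equalizer-of-identity {b = b} {p} {q} b≈id E = begin
    p ∘ E.arr          ≈⟨ sym identityˡ ⟩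
    id ∘ (p ∘ E.arr)   ≈⟨ ∘-congˡ (sym b≈id) ⟩
    b ∘ (p ∘ E.arr)    ≈⟨ sym-assoc ⟩
    (b ∘ p) ∘ E.arr    ≈⟨ E.equality ⟩
    (b ∘ q) ∘ E.arr    ≈⟨ assoc ⟩
    b ∘ (q ∘ E.arr)    ≈⟨ ∘-congˡ b≈id ⟩
    id ∘ (q ∘ E.arr)   ≈⟨ identityˡ ⟩
    q ∘ E.arr          ∎
    where module E = Equalizer E

  kernel-in-diagonal⇒mono :
    ∀ {X Y} {f : X ⇒ Y} (Pr : Product C X X) →
    let open Product Pr in
    (K : Equalizer C (f ∘ π₁) (f ∘ π₂)) →
    π₁ ∘ Equalizer.arr K ≈ π₂ ∘ Equalizer.arr K → Mono C f
  kernel-in-diagonal⇒mono {f = f} Pr K diag {W} g h fg≈fh = begin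
    g                        ≈⟨ sym project₁ ⟩
    π₁ ∘ ⟨ g , h ⟩           ≈⟨ ∘-congʳ K.universal ⟩
    π₁ ∘ (K.arr ∘ k)         ≈⟨ sym-assoc ⟩
    (π₁ ∘ K.arr) ∘ k         ≈⟨ ∘-congˡ diag ⟩
    (π₂ ∘ K.arr) ∘ k         ≈⟨ assoc ⟩
    π₂ ∘ (K.arr ∘ k)         ≈⟨ ∘-congʳ (sym K.universal) ⟩
    π₂ ∘ ⟨ g , h ⟩           ≈⟨ project₂ ⟩
    h                        ∎
    where
      open Product Pr
      module K = Equalizer K
      pair-equalized : (f ∘ π₁) ∘ ⟨ g , h ⟩ ≈ (f ∘ π₂) ∘ ⟨ g , h ⟩
      pair-equalized = begin
        (f ∘ π₁) ∘ ⟨ g , h ⟩  ≈⟨ assoc ⟩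
        f ∘ (π₁ ∘ ⟨ g , h ⟩)  ≈⟨ ∘-congʳ project₁ ⟩
        f ∘ g                 ≈⟨ fg≈fh ⟩
        f ∘ h                 ≈⟨ ∘-congʳ (sym project₂) ⟩
        f ∘ (π₂ ∘ ⟨ g , h ⟩)  ≈⟨ sym-assoc ⟩
        (f ∘ π₂) ∘ ⟨ g , h ⟩  ∎
      k : W ⇒ K.obj
      k = K.equalize pair-equalized

module InitialAlgebraFacts {o ℓ e} {A : Category o ℓ e} (M : Functor A A)
                           (ini : InitialAlgebra M) where
  open HomReasoning A
  open InitialAlgebra ini
  private module M = Functor M

  alg-hom-∘ : ∀ {a b c : Algebra M} {f : Algebra.X a ⇒ Algebra.X b}
              {g : Algebra.X b ⇒ Algebra.X c} →
              IsAlgHom M a b f → IsAlgHom M b c g → IsAlgHom M a c (g ∘ f)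
  alg-hom-∘ {a} {b} {c} {f} {g} f-hom g-hom = begin
    (g ∘ f) ∘ Algebra.a a               ≈⟨ assoc ⟩
    g ∘ (f ∘ Algebra.a a)               ≈⟨ ∘-congʳ f-hom ⟩
    g ∘ (Algebra.a b ∘ M.F₁ f)          ≈⟨ sym-assoc ⟩
    (g ∘ Algebra.a b) ∘ M.F₁ f          ≈⟨ ∘-congˡ g-hom ⟩
    (Algebra.a c ∘ M.F₁ g) ∘ M.F₁ f     ≈⟨ assoc ⟩
    Algebra.a c ∘ (M.F₁ g ∘ M.F₁ f)     ≈⟨ ∘-congʳ (sym M.homomorphism) ⟩
    Algebra.a c ∘ M.F₁ (g ∘ f)          ∎

  fold-fusion : ∀ {a b : Algebra M} {h : Algebra.X a ⇒ Algebra.X b} →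
                IsAlgHom M a b h → h ∘ fold a ≈ fold b
  fold-fusion {a} {b} {h} h-hom =
    fold-unique b (h ∘ fold a) (alg-hom-∘ (fold-hom a) h-hom)

module FinalCoalgebraFacts {o ℓ e} {C : Category o ℓ e} (F : Functor C C)
                           (fin : FinalCoalgebra F) where
  open HomReasoning C
  open FinalCoalgebra fin
  private module F = Functor F

  unfold-final≈id : unfold coalg ≈ id
  unfold-final≈id = sym (unfold-unique coalg id id-hom)
    where
      ζ : Coalgebra.X coalg ⇒ F.F₀ (Coalgebra.X coalg)
      ζ = Coalgebra.c coalg
      id-hom : ζ ∘ id ≈ F.F₁ id ∘ ζ
      id-hom = begin
        ζ ∘ id         ≈⟨ identityʳ ⟩
        ζ              ≈⟨ sym identityˡ ⟩
        id ∘ ζ         ≈⟨ ∘-congˡ (sym F.identity) ⟩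
        F.F₁ id ∘ ζ    ∎

module TheoryMaps
  {o ℓ e o' ℓ' e'} {C : Category o ℓ e} {A : Category o' ℓ' e'}
  (P : Functor (op C) A) (Sop : Functor A (op C)) (adj : Adjoint Sop P)
  (F : Functor C C) (M : Functor A A)
  (δ : NatTrans (M ∘F P) (P ∘F opF F))
  (lim : FiniteLimits C) (ini : InitialAlgebra M) (fin : FinalCoalgebra F)
  where
  open Setting P Sop adj F M δ lim ini fin
  open Coalgebra using (X)
  private
    module C = HomReasoning C
    module A = HomReasoning A
    module P = Functor P
    module S = Functor Sop
    module F = Functor F
    module M = Functor M
    module δ = NatTrans δ
    module ε = NatTrans (Adjoint.counit adj)
    module fin = FinalCoalgebra fin

  -- A coalgebra morphism h : c → d gives an algebra morphism
  -- P h : (Pd ∘ δ) → (Pc ∘ δ); this is where naturality of δ is used.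
  P-alg-hom : (c d : Coalgebra F) (h : X c C.⇒ X d) → IsCoalgHom F c d h →
              IsAlgHom M (PAlg d) (PAlg c) (P.F₁ h)
  P-alg-hom c d h h-hom = begin
    P.F₁ h ∘ (P.F₁ γ ∘ δ.η (X d))          ≈⟨ sym-assoc ⟩
    (P.F₁ h ∘ P.F₁ γ) ∘ δ.η (X d)          ≈⟨ ∘-congˡ (sym P.homomorphism) ⟩
    P.F₁ (γ C.∘ h) ∘ δ.η (X d)             ≈⟨ ∘-congˡ (P.F-resp-≈ h-hom) ⟩
    P.F₁ (F.F₁ h C.∘ κ) ∘ δ.η (X d)        ≈⟨ ∘-congˡ P.homomorphism ⟩
    (P.F₁ κ ∘ P.F₁ (F.F₁ h)) ∘ δ.η (X d)   ≈⟨ assoc ⟩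
    P.F₁ κ ∘ (P.F₁ (F.F₁ h) ∘ δ.η (X d))   ≈⟨ ∘-congʳ (sym (δ.commute h)) ⟩
    P.F₁ κ ∘ (δ.η (X c) ∘ M.F₁ (P.F₁ h))   ≈⟨ sym-assoc ⟩
    (P.F₁ κ ∘ δ.η (X c)) ∘ M.F₁ (P.F₁ h)   ∎
    where
      open A
      κ : X c C.⇒ F.F₀ (X c)
      κ = Coalgebra.c c
      γ : X d C.⇒ F.F₀ (X d)
      γ = Coalgebra.c d

  interp-natural : (c d : Coalgebra F) (h : X c C.⇒ X d) → IsCoalgHom F c d h →
                   P.F₁ h A.∘ interp d A.≈ interp c
  interp-natural c d h h-hom =
    InitialAlgebraFacts.fold-fusion M ini (P-alg-hom c d h h-hom)

  transpose-natural : ∀ {Y W} (h : Y C.⇒ W) (f : L A.⇒ P.F₀ W) →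
                      transpose f C.∘ h C.≈ transpose (P.F₁ h A.∘ f)
  transpose-natural {Y} {W} h f = begin
    (S.F₁ f ∘ ε.η W) ∘ h             ≈⟨ assoc ⟩
    S.F₁ f ∘ (ε.η W ∘ h)             ≈⟨ ∘-congʳ (sym (ε.commute h)) ⟩
    S.F₁ f ∘ (S.F₁ (P.F₁ h) ∘ ε.η Y) ≈⟨ sym-assoc ⟩
    (S.F₁ f ∘ S.F₁ (P.F₁ h)) ∘ ε.η Y ≈⟨ ∘-congˡ (sym S.homomorphism) ⟩
    S.F₁ (P.F₁ h A.∘ f) ∘ ε.η Y      ∎
    where open C

  th-natural : (c d : Coalgebra F) (h : X c C.⇒ X d) → IsCoalgHom F c d h →
               th d C.∘ h C.≈ th c
  th-natural c d h h-hom = begin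
    transpose (interp d) ∘ h            ≈⟨ transpose-natural h (interp d) ⟩
    transpose (P.F₁ h A.∘ interp d)     ≈⟨ ∘-congˡ (S.F-resp-≈ (interp-natural c d h h-hom)) ⟩
    transpose (interp c)                ∎
    where open C

  th-factors-through-beh : (c : Coalgebra F) → thζ C.∘ beh c C.≈ th c
  th-factors-through-beh c = th-natural c fin.coalg (beh c) (fin.unfold-hom c)

  mono⇒TestEq≅FCSEq : Mono C thζ → (c : Coalgebra F) → TestEq≅FCSEq c
  mono⇒TestEq≅FCSEq mono c =
    equalizers-same-subobject (TestEq c) (FCSEq c)
      (mono-factor-same-kernel mono (C.sym (th-factors-through-beh c)))
    where open Equalizers C

  TestEq≅FCSEq⇒mono : ((c : Coalgebra F) → TestEq≅FCSEq c) → Mono C thζ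
  TestEq≅FCSEq⇒mono same-subobjects =
    kernel-in-diagonal⇒mono ζ×ζ (TestEq ζ)
      (equalized-same-subobject (same-subobjects ζ) FCSEq-in-diagonal)
    where
      open Equalizers C
      ζ : Coalgebra F
      ζ = fin.coalg
      ζ×ζ : Product C (X ζ) (X ζ)
      ζ×ζ = FiniteLimits.product lim (X ζ) (X ζ)
      open Product ζ×ζ using (π₁; π₂)
      FCSEq-in-diagonal : π₁ C.∘ Equalizer.arr (FCSEq ζ) C.≈ π₂ C.∘ Equalizer.arr (FCSEq ζ)
      FCSEq-in-diagonal = equalizer-of-identity
        (FinalCoalgebraFacts.unfold-final≈id F fin) (FCSEq ζ)

proposition5p6 : ∀ {o ℓ e o' ℓ' e'} {C : Category o ℓ e} {A : Category o' ℓ' e'}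
    (P : Functor (op C) A) (Sop : Functor A (op C)) (adj : Adjoint Sop P)
    (F : Functor C C) (M : Functor A A)
    (δ : NatTrans (M ∘F P) (P ∘F opF F))
    (lim : FiniteLimits C) (ini : InitialAlgebra M) (fin : FinalCoalgebra F) →
    ((c : Coalgebra F) → Setting.TestEq≅FCSEq P Sop adj F M δ lim ini fin c)
      ⇔ Mono C (Setting.thζ P Sop adj F M δ lim ini fin)
proposition5p6 P Sop adj F M δ lim ini fin =
  mk⇔ TestEq≅FCSEq⇒mono mono⇒TestEq≅FCSEq
  where open TheoryMaps P Sop adj F M δ lim ini fin
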